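{- For $k\ge 1$ let $p(k)$ be the probability that two independent uniformly random elements of $S_{2k}$, each of cycle type $(2^k)$ (i.e. fixed-point-free involutions), generate a transitive subgroup of $S_{2k}$. Then $p(k) \asymp k^{ -1/2}$, i.e. there are absolute constants $0<a<b$ with $a k^{ -1/2}\le p(k)\le b k^{ -1/2}$ for all $k\ge1$. -}

module Defs where

open import Data.Nat using (ℕ; _*_)
open import Data.Fin using (Fin)
open import Data.Vec using (Vec; lookup)
open import Data.Sum using (_⊎_)
open import Data.Integer using (+_)
open import Data.Rational using (ℚ; _/_)
open import Relation.Binary.PropositionalEquality using (_≡_; _≢_)
open import Relation.Binary.Construct.Closure.ReflexiveTransitive using (Star)

-- A permutation-like map of Fin n is represented by its table of values
-- (a vector), so that equality of maps is decidable / extensional.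
-- A fixed-point-free involution of {0,…,n-1}: σ ∘ σ = id and σ i ≠ i for all i.
-- (σ ∘ σ = id already makes σ a bijection, i.e. an element of S_n;
--  for n = 2k these are exactly the elements of cycle type (2^k).)
-- The proof fields are irrelevant, so an element is determined by its table.
record FPFI (n : ℕ) : Set where
  constructor fpfi
  field
    table  : Vec (Fin n) n
    .invol : ∀ i → lookup table (lookup table i) ≡ i
    .noFix : ∀ i → lookup table i ≢ i
open FPFI public

-- Since σ, τ are involutions, σ⁻¹ = σ and τ⁻¹ = τ, so the orbits of the
-- group ⟨σ,τ⟩ are exactly the equivalence classes of the reflexive–transitive
-- closure of this step relation.
Step : ∀ {n} → FPFI n → FPFI n → Fin n → Fin n → Set
Step σ τ x y = (y ≡ lookup (table σ) x) ⊎ (y ≡ lookup (table τ) x)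

Transitive : ∀ {n} → FPFI n → FPFI n → Set
Transitive σ τ = ∀ x y → Star (Step σ τ) x y

record TransPair (k : ℕ) : Set where
  constructor tpair
  field
    σ : FPFI (2 * k)
    τ : FPFI (2 * k)
    .trans : Transitive σ τ

ℕtoℚ : ℕ → ℚ
ℕtoℚ n = (+ n) / 1

module Submission where

-- Delete the point 0 and its σ-partner a. For fixed-point-free involutions this is a bijection
-- FPFI (n + 2) ≅ Fin (n + 1) × FPFI n, so there are (2k − 1)!! of them on 2k points. For a transitive
-- pair (σ, τ) on n + 2 ≥ 3 points, b = τ 0 differs from a; replacing the τ-cycles (0 b)(a c) by (b c)
-- gives a transitive pair on the remaining n points, and this is a bijection onto
-- Fin (n + 1) × Fin n × (transitive pairs on n points). Hence T(k) = (2k − 1)!! (2k − 2)!!, so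
-- p(k) = T(k) / ((2k − 1)!!)² = (2k − 2)!! / (2k − 1)!!, and the Wallis-type bounds
-- k ((2k − 2)!!)² ≤ ((2k − 1)!!)² ≤ 4k ((2k − 2)!!)² give 1/4 ≤ k p(k)² ≤ 1.

open import Defs
open import Data.Nat using (ℕ; _≤_; _^_; _*_)
open import Data.Fin using (Fin)
open import Data.Product using (∃-syntax; _×_)
open import Function.Bundles using (_↔_)
open import Data.Rational using (ℚ; 0ℚ) renaming (_≤_ to _≤ℚ_; _<_ to _<ℚ_; _*_ to _*ℚ_)

open import Data.Empty using (⊥-elim; ⊥-elim-irr)
open import Data.Fin using (zero; suc; punchIn; punchOut)
open import Data.Fin.Permutation using (Permutation′; _⟨$⟩ʳ_; _⟨$⟩ˡ_; inverseˡ; inverseʳ; flip; transpose; ↔⇒≡)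
import Data.Fin.Permutation.Components as PC
open import Data.Fin.Properties
  using (_≟_; suc-injective; punchIn-injective; punchInᵢ≢i; punchIn-punchOut; punchOut-punchIn; punchOut-cong; *↔×)
open import Data.Integer as ℤ using (+_)
import Data.Integer.Properties as ℤ
open import Data.Nat using (zero; suc; _+_)
open import Data.Nat.Coprimality using (Coprime; 1-coprimeTo) renaming (sym to coprime-sym)
open import Data.Nat.Properties
  using (*-commutativeSemigroup; *-suc; *-identityʳ; *-identityˡ; *-comm; *-assoc; ≤-refl;
         *-monoʳ-≤; *-monoˡ-≤; n≤1+n; m≤n*m; module ≤-Reasoning)
open import Algebra.Properties.CommutativeSemigroup *-commutativeSemigroup using (x∙yz≈y∙xz)
open import Data.Nat.Tactic.RingSolver using (solve-∀)
open import Data.Product using (_,_; proj₁; proj₂)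
open import Data.Product.Function.NonDependent.Propositional using (_×-↔_)
open import Data.Rational using (mkℚ; ½; 1ℚ; toℚᵘ)
open import Data.Rational.Properties using (_<?_; normalize-coprime; toℚᵘ-cancel-≤; toℚᵘ-homo-*)
import Data.Rational.Unnormalised as ℚᵘ
import Data.Rational.Unnormalised.Properties as ℚᵘ
open import Data.Sum using (_⊎_; inj₁; inj₂; [_,_]′)
open import Data.Unit using (tt)
open import Data.Vec using ([]; lookup; tabulate)
open import Data.Vec.Properties using (lookup∘tabulate; tabulate∘lookup; tabulate-cong)
open import Function.Base using (_∘_)
open import Function.Bundles using (mk↔ₛ′; Inverse)
open import Function.Properties.Inverse using (↔-refl; ↔-sym; ↔-trans)
open import Function.Related.Propositional using (module EquationalReasoning)
open import Relation.Binary.Construct.Closure.ReflexiveTransitive using (Star; ε; _◅_; _◅◅_; kleisliStar)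
open import Relation.Binary.PropositionalEquality
open import Relation.Nullary using (yes; no)
open import Relation.Nullary.Decidable using (recompute; dec-true; dec-false; toWitness)

private
  variable
    n : ℕ

infixr 5 _⟨$⟩_

_⟨$⟩_ : FPFI n → Fin n → Fin n
σ ⟨$⟩ i = lookup (table σ) i

⟨$⟩-involutive : (σ : FPFI n) (i : Fin n) → σ ⟨$⟩ σ ⟨$⟩ i ≡ i
⟨$⟩-involutive σ@(fpfi _ involutive _) i = recompute (σ ⟨$⟩ σ ⟨$⟩ i ≟ i) (involutive i)

⟨$⟩-noFix : (σ : FPFI n) (i : Fin n) → σ ⟨$⟩ i ≢ i
⟨$⟩-noFix (fpfi _ _ noFix′) i eq = ⊥-elim-irr (noFix′ i eq)

⟨$⟩-symmetric : (σ : FPFI n) {i j : Fin n} → σ ⟨$⟩ i ≡ j → σ ⟨$⟩ j ≡ i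
⟨$⟩-symmetric σ {i} refl = ⟨$⟩-involutive σ i

⟨$⟩-injective : (σ : FPFI n) {i j : Fin n} → σ ⟨$⟩ i ≡ σ ⟨$⟩ j → i ≡ j
⟨$⟩-injective σ {i} {j} eq = trans (sym (⟨$⟩-symmetric σ eq)) (⟨$⟩-involutive σ j)

fromInvolution : (f : Fin n → Fin n) → .(∀ i → f (f i) ≡ i) → .(∀ i → f i ≢ i) → FPFI n
fromInvolution f f-involutive f-noFix = fpfi (tabulate f)
  (λ i → trans (cong (lookup (tabulate f)) (lookup∘tabulate f i))
               (trans (lookup∘tabulate f (f i)) (f-involutive i)))
  (λ i eq → f-noFix i (trans (sym (lookup∘tabulate f i)) eq))

FPFI-ext : {σ τ : FPFI n} → (∀ i → σ ⟨$⟩ i ≡ τ ⟨$⟩ i) → σ ≡ τ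
FPFI-ext {σ = fpfi s _ _} {fpfi t _ _} eq = table-≡
  (trans (sym (tabulate∘lookup s)) (trans (tabulate-cong eq) (tabulate∘lookup t)))
  where
  table-≡ : ∀ {s t} .{p p′ q q′} → s ≡ t → fpfi {n} s p q ≡ fpfi t p′ q′
  table-≡ refl = refl

conjugate : Permutation′ n → FPFI n → FPFI n
conjugate π σ = fromInvolution (λ i → π ⟨$⟩ʳ (σ ⟨$⟩ (π ⟨$⟩ˡ i))) involutive noFix′
  where
  involutive : ∀ i → π ⟨$⟩ʳ (σ ⟨$⟩ (π ⟨$⟩ˡ (π ⟨$⟩ʳ (σ ⟨$⟩ (π ⟨$⟩ˡ i))))) ≡ i
  involutive i = trans (cong (λ j → π ⟨$⟩ʳ (σ ⟨$⟩ j)) (inverseˡ π))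
                       (trans (cong (π ⟨$⟩ʳ_) (⟨$⟩-involutive σ _)) (inverseʳ π))
  noFix′ : ∀ i → π ⟨$⟩ʳ (σ ⟨$⟩ (π ⟨$⟩ˡ i)) ≢ i
  noFix′ i eq = ⟨$⟩-noFix σ _ (trans (sym (inverseˡ π)) (cong (π ⟨$⟩ˡ_) eq))

⟨$⟩-conjugate : (π : Permutation′ n) (σ : FPFI n) (i : Fin n) →
                conjugate π σ ⟨$⟩ i ≡ π ⟨$⟩ʳ (σ ⟨$⟩ (π ⟨$⟩ˡ i))
⟨$⟩-conjugate π σ = lookup∘tabulate _

conjugate-flip-conjugate : (π : Permutation′ n) (σ : FPFI n) → conjugate (flip π) (conjugate π σ) ≡ σ
conjugate-flip-conjugate π σ = FPFI-ext λ i → begin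
  conjugate (flip π) (conjugate π σ) ⟨$⟩ i       ≡⟨ ⟨$⟩-conjugate (flip π) (conjugate π σ) i ⟩
  π ⟨$⟩ˡ (conjugate π σ ⟨$⟩ (π ⟨$⟩ʳ i))           ≡⟨ cong (π ⟨$⟩ˡ_) (⟨$⟩-conjugate π σ (π ⟨$⟩ʳ i)) ⟩
  π ⟨$⟩ˡ (π ⟨$⟩ʳ (σ ⟨$⟩ (π ⟨$⟩ˡ (π ⟨$⟩ʳ i))))     ≡⟨ inverseˡ π ⟩
  σ ⟨$⟩ (π ⟨$⟩ˡ (π ⟨$⟩ʳ i))                      ≡⟨ cong (σ ⟨$⟩_) (inverseˡ π) ⟩
  σ ⟨$⟩ i                                        ∎
  where open ≡-Reasoning

conjugate-conjugate-flip : (π : Permutation′ n) (σ : FPFI n) → conjugate π (conjugate (flip π) σ) ≡ σ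
conjugate-conjugate-flip π = conjugate-flip-conjugate (flip π)

transpose-matchˡ : (i j : Fin n) → PC.transpose i j i ≡ j
transpose-matchˡ i j rewrite dec-true (i ≟ i) refl = refl

transpose-matchʳ : (i j : Fin n) → PC.transpose i j j ≡ i
transpose-matchʳ i j with j ≟ i
... | yes j≡i = j≡i
... | no _ rewrite dec-true (j ≟ j) refl = refl

transpose-other : (i j : Fin n) {k : Fin n} → k ≢ i → k ≢ j → PC.transpose i j k ≡ k
transpose-other i j {k} k≢i k≢j rewrite dec-false (k ≟ i) k≢i | dec-false (k ≟ j) k≢j = refl

module WithPartner {n : ℕ} (a : Fin (suc n)) where

  partner : Fin (2 + n)
  partner = suc a

  embed : Fin n → Fin (2 + n)
  embed y = suc (punchIn a y)

  embed-injective : {y z : Fin n} → embed y ≡ embed z → y ≡ z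
  embed-injective eq = punchIn-injective a _ _ (suc-injective eq)

  zero≢partner : zero ≢ partner
  zero≢partner ()

  embed≢zero : {y : Fin n} → embed y ≢ zero
  embed≢zero ()

  embed≢partner : {y : Fin n} → embed y ≢ partner
  embed≢partner {y} eq = punchInᵢ≢i a y (suc-injective eq)

  unembed : (x : Fin (2 + n)) → .(x ≢ zero) → .(x ≢ partner) → Fin n
  unembed zero    x≢0 _ = ⊥-elim-irr (x≢0 refl)
  unembed (suc x) _ x≢a = punchOut {i = a} {j = x} λ a≡x → ⊥-elim-irr (x≢a (cong suc (sym a≡x)))

  embed-unembed : (x : Fin (2 + n)) .(x≢0 : x ≢ zero) .(x≢a : x ≢ partner) → embed (unembed x x≢0 x≢a) ≡ x
  embed-unembed zero    x≢0 _ = ⊥-elim-irr (x≢0 refl)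
  embed-unembed (suc x) _   _ = cong suc (punchIn-punchOut _)

  data Point : Fin (2 + n) → Set where
    at-zero    : Point zero
    at-partner : Point partner
    at-embed   : (y : Fin n) → Point (embed y)

  point : (x : Fin (2 + n)) → Point x
  point zero = at-zero
  point (suc x) with a ≟ x
  ... | yes refl = at-partner
  ... | no a≢x   = subst Point (cong suc (punchIn-punchOut a≢x)) (at-embed (punchOut a≢x))

  extend : (Fin n → Fin n) → Fin (2 + n) → Fin (2 + n)
  extend f zero = partner
  extend f (suc x) with a ≟ x
  ... | yes _  = zero
  ... | no a≢x = embed (f (punchOut a≢x))

  extend-partner : (f : Fin n → Fin n) → extend f partner ≡ zero
  extend-partner f with a ≟ a
  ... | yes _  = refl
  ... | no a≢a = ⊥-elim (a≢a refl)

  extend-embed : (f : Fin n → Fin n) (y : Fin n) → extend f (embed y) ≡ embed (f y)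
  extend-embed f y with a ≟ punchIn a y
  ... | yes a≡y = ⊥-elim (punchInᵢ≢i a y (sym a≡y))
  ... | no a≢y  = cong (embed ∘ f) (trans (punchOut-cong a refl) (punchOut-punchIn a))

  addPair : FPFI n → FPFI (2 + n)
  addPair σ = fromInvolution (extend (σ ⟨$⟩_)) (λ x → involutive (point x)) (λ x → noFix′ (point x))
    where
    involutive : {x : Fin (2 + n)} → Point x → extend (σ ⟨$⟩_) (extend (σ ⟨$⟩_) x) ≡ x
    involutive at-zero      = extend-partner _
    involutive at-partner   = cong (extend _) (extend-partner _)
    involutive (at-embed y) = trans (cong (extend _) (extend-embed _ y))
                                    (trans (extend-embed _ _) (cong embed (⟨$⟩-involutive σ y)))
    noFix′ : {x : Fin (2 + n)} → Point x → extend (σ ⟨$⟩_) x ≢ x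
    noFix′ at-partner   eq = zero≢partner (trans (sym (extend-partner _)) eq)
    noFix′ (at-embed y) eq = ⟨$⟩-noFix σ y (embed-injective (trans (sym (extend-embed _ y)) eq))

  addPair-zero : (σ : FPFI n) → addPair σ ⟨$⟩ zero ≡ partner
  addPair-zero σ = refl

  addPair-partner : (σ : FPFI n) → addPair σ ⟨$⟩ partner ≡ zero
  addPair-partner σ = ⟨$⟩-symmetric (addPair σ) (addPair-zero σ)

  addPair-embed : (σ : FPFI n) (y : Fin n) → addPair σ ⟨$⟩ embed y ≡ embed (σ ⟨$⟩ y)
  addPair-embed σ y = trans (lookup∘tabulate (extend (σ ⟨$⟩_)) (embed y)) (extend-embed _ y)

  restrict : (σ : FPFI (2 + n)) → .(σ ⟨$⟩ zero ≡ partner) → Fin n → Fin n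
  restrict σ σ0≡a y = unembed (σ ⟨$⟩ embed y)
    (λ eq → embed≢partner (⟨$⟩-injective σ (trans eq (sym (⟨$⟩-symmetric σ σ0≡a)))))
    (λ eq → embed≢zero (⟨$⟩-injective σ (trans eq (sym σ0≡a))))

  embed-restrict : (σ : FPFI (2 + n)) .(σ0≡a : σ ⟨$⟩ zero ≡ partner) (y : Fin n) →
                   embed (restrict σ σ0≡a y) ≡ σ ⟨$⟩ embed y
  embed-restrict σ σ0≡a y = embed-unembed _ _ _

  removePair : (σ : FPFI (2 + n)) → .(σ ⟨$⟩ zero ≡ partner) → FPFI n
  removePair σ σ0≡a = fromInvolution f involutive noFix′
    where
    f : Fin n → Fin n
    f = restrict σ σ0≡a
    involutive : ∀ y → f (f y) ≡ y
    involutive y = embed-injective (begin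
      embed (f (f y))         ≡⟨ embed-restrict σ σ0≡a (f y) ⟩
      σ ⟨$⟩ embed (f y)       ≡⟨ cong (σ ⟨$⟩_) (embed-restrict σ σ0≡a y) ⟩
      σ ⟨$⟩ σ ⟨$⟩ embed y     ≡⟨ ⟨$⟩-involutive σ (embed y) ⟩
      embed y                 ∎)
      where open ≡-Reasoning
    noFix′ : ∀ y → f y ≢ y
    noFix′ y eq = ⟨$⟩-noFix σ (embed y) (trans (sym (embed-restrict σ σ0≡a y)) (cong embed eq))

  embed-removePair : (σ : FPFI (2 + n)) .(σ0≡a : σ ⟨$⟩ zero ≡ partner) (y : Fin n) →
                     embed (removePair σ σ0≡a ⟨$⟩ y) ≡ σ ⟨$⟩ embed y
  embed-removePair σ σ0≡a y = trans (cong embed (lookup∘tabulate (restrict σ σ0≡a) y)) (embed-restrict σ σ0≡a y)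

  removePair-cong : {σ τ : FPFI (2 + n)} → σ ≡ τ →
                    .(σ0≡a : σ ⟨$⟩ zero ≡ partner) .(τ0≡a : τ ⟨$⟩ zero ≡ partner) →
                    removePair σ σ0≡a ≡ removePair τ τ0≡a
  removePair-cong refl _ _ = refl

  addPair-removePair : (σ : FPFI (2 + n)) (σ0≡a : σ ⟨$⟩ zero ≡ partner) → addPair (removePair σ σ0≡a) ≡ σ
  addPair-removePair σ σ0≡a = FPFI-ext (λ x → agree (point x))
    where
    agree : {x : Fin (2 + n)} → Point x → addPair (removePair σ σ0≡a) ⟨$⟩ x ≡ σ ⟨$⟩ x
    agree at-zero      = sym σ0≡a
    agree at-partner   = trans (addPair-partner (removePair σ σ0≡a)) (sym (⟨$⟩-symmetric σ σ0≡a))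
    agree (at-embed y) = trans (addPair-embed (removePair σ σ0≡a) y) (embed-removePair σ σ0≡a y)

  removePair-addPair : (σ : FPFI n) .(σ0≡a : addPair σ ⟨$⟩ zero ≡ partner) → removePair (addPair σ) σ0≡a ≡ σ
  removePair-addPair σ σ0≡a = FPFI-ext λ y → embed-injective
    (trans (embed-removePair (addPair σ) σ0≡a y) (addPair-embed σ y))

  swapWithPartner : Fin n → Permutation′ (2 + n)
  swapWithPartner b = transpose partner (embed b)

  -- Conjugating addPair τ = (0 partner)(b τb)⋯ by the transposition (partner b) gives (0 b)(partner τb)⋯.
  splitCycle : Fin n → FPFI n → FPFI (2 + n)
  splitCycle b τ = conjugate (swapWithPartner b) (addPair τ)

  module _ (b : Fin n) where
    private
      swap swap⁻¹ : Fin (2 + n) → Fin (2 + n)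
      swap   = PC.transpose partner (embed b)
      swap⁻¹ = PC.transpose (embed b) partner

    splitCycle-zero : (τ : FPFI n) → splitCycle b τ ⟨$⟩ zero ≡ embed b
    splitCycle-zero τ = begin
      splitCycle b τ ⟨$⟩ zero           ≡⟨ ⟨$⟩-conjugate (swapWithPartner b) (addPair τ) zero ⟩
      swap (addPair τ ⟨$⟩ swap⁻¹ zero)
        ≡⟨ cong (swap ∘ (addPair τ ⟨$⟩_)) (transpose-other (embed b) partner (λ ()) zero≢partner) ⟩
      swap partner                      ≡⟨ transpose-matchˡ partner (embed b) ⟩
      embed b                           ∎
      where open ≡-Reasoning

    splitCycle-partner : (τ : FPFI n) → splitCycle b τ ⟨$⟩ partner ≡ embed (τ ⟨$⟩ b)
    splitCycle-partner τ = begin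
      splitCycle b τ ⟨$⟩ partner          ≡⟨ ⟨$⟩-conjugate (swapWithPartner b) (addPair τ) partner ⟩
      swap (addPair τ ⟨$⟩ swap⁻¹ partner) ≡⟨ cong (swap ∘ (addPair τ ⟨$⟩_)) (transpose-matchʳ (embed b) partner) ⟩
      swap (addPair τ ⟨$⟩ embed b)        ≡⟨ cong swap (addPair-embed τ b) ⟩
      swap (embed (τ ⟨$⟩ b))
        ≡⟨ transpose-other partner (embed b) embed≢partner (⟨$⟩-noFix τ b ∘ embed-injective) ⟩
      embed (τ ⟨$⟩ b)                     ∎
      where open ≡-Reasoning

    splitCycle-embed : (τ : FPFI n) {y : Fin n} → y ≢ b → y ≢ τ ⟨$⟩ b →
                       splitCycle b τ ⟨$⟩ embed y ≡ embed (τ ⟨$⟩ y)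
    splitCycle-embed τ {y} y≢b y≢τb = begin
      splitCycle b τ ⟨$⟩ embed y          ≡⟨ ⟨$⟩-conjugate (swapWithPartner b) (addPair τ) (embed y) ⟩
      swap (addPair τ ⟨$⟩ swap⁻¹ (embed y))
        ≡⟨ cong (swap ∘ (addPair τ ⟨$⟩_)) (transpose-other (embed b) partner (y≢b ∘ embed-injective) embed≢partner) ⟩
      swap (addPair τ ⟨$⟩ embed y)        ≡⟨ cong swap (addPair-embed τ y) ⟩
      swap (embed (τ ⟨$⟩ y))              ≡⟨ transpose-other partner (embed b) embed≢partner τy≢b ⟩
      embed (τ ⟨$⟩ y)                     ∎
      where
      open ≡-Reasoning
      τy≢b : embed (τ ⟨$⟩ y) ≢ embed b
      τy≢b eq = y≢τb (sym (⟨$⟩-symmetric τ (embed-injective eq)))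

    unswap-zero : (τ : FPFI (2 + n)) → τ ⟨$⟩ zero ≡ embed b →
                  conjugate (flip (swapWithPartner b)) τ ⟨$⟩ zero ≡ partner
    unswap-zero τ τ0≡b = begin
      conjugate (flip (swapWithPartner b)) τ ⟨$⟩ zero ≡⟨ ⟨$⟩-conjugate (flip (swapWithPartner b)) τ zero ⟩
      swap⁻¹ (τ ⟨$⟩ swap zero)
        ≡⟨ cong (swap⁻¹ ∘ (τ ⟨$⟩_)) (transpose-other partner (embed b) zero≢partner (λ ())) ⟩
      swap⁻¹ (τ ⟨$⟩ zero)                             ≡⟨ cong swap⁻¹ τ0≡b ⟩
      swap⁻¹ (embed b)                                ≡⟨ transpose-matchˡ (embed b) partner ⟩
      partner                                         ∎
      where open ≡-Reasoning

  mergeCycle : (b : Fin n) (τ : FPFI (2 + n)) → .(τ ⟨$⟩ zero ≡ embed b) → FPFI n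
  mergeCycle b τ τ0≡b = removePair (conjugate (flip (swapWithPartner b)) τ) (unswap-zero b τ τ0≡b)

  mergeCycle-splitCycle : {b′ b : Fin n} (τ : FPFI n) → b′ ≡ b → .(τ0≡b′ : splitCycle b τ ⟨$⟩ zero ≡ embed b′) →
                          mergeCycle b′ (splitCycle b τ) τ0≡b′ ≡ τ
  mergeCycle-splitCycle {b = b} τ refl _ = trans
    (removePair-cong (conjugate-flip-conjugate (swapWithPartner b) (addPair τ))
                     (unswap-zero b (splitCycle b τ) (splitCycle-zero b τ)) refl)
    (removePair-addPair τ refl)

  splitCycle-mergeCycle : (b : Fin n) (τ : FPFI (2 + n)) (τ0≡b : τ ⟨$⟩ zero ≡ embed b) →
                          splitCycle b (mergeCycle b τ τ0≡b) ≡ τ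
  splitCycle-mergeCycle b τ τ0≡b = trans
    (cong (conjugate (swapWithPartner b))
          (addPair-removePair (conjugate (flip (swapWithPartner b)) τ) (unswap-zero b τ τ0≡b)))
    (conjugate-conjugate-flip (swapWithPartner b) τ)

module SplitTransitivity {n : ℕ} (a : Fin (suc n)) (b : Fin n) (σ τ : FPFI n) where
  open WithPartner a

  σ₂ τ₂ : FPFI (2 + n)
  σ₂ = addPair σ
  τ₂ = splitCycle b τ

  c : Fin n
  c = τ ⟨$⟩ b

  τ₂-zero : τ₂ ⟨$⟩ zero ≡ embed b
  τ₂-zero = splitCycle-zero b τ

  τ₂-partner : τ₂ ⟨$⟩ partner ≡ embed c
  τ₂-partner = splitCycle-partner b τ

  τ₂-embed-b : τ₂ ⟨$⟩ embed b ≡ zero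
  τ₂-embed-b = ⟨$⟩-symmetric τ₂ {zero} τ₂-zero

  τ₂-embed-c : τ₂ ⟨$⟩ embed c ≡ partner
  τ₂-embed-c = ⟨$⟩-symmetric τ₂ {partner} τ₂-partner

  -- x Over u: collapsing 0 onto b and partner onto c sends x to u.
  infix 4 _Over_
  data _Over_ : Fin (2 + n) → Fin n → Set where
    zero-over    : zero Over b
    partner-over : partner Over c
    embed-over   : (y : Fin n) → embed y Over y

  Over-resp : {x y : Fin (2 + n)} {u : Fin n} → y ≡ x → x Over u → y Over u
  Over-resp refl x/u = x/u

  Over-embed : {x : Fin (2 + n)} {u v : Fin n} → x Over u → x ≡ embed v → u ≡ v
  Over-embed partner-over   eq = ⊥-elim (embed≢partner (sym eq))
  Over-embed (embed-over y) eq = embed-injective eq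

  lies-over : (x : Fin (2 + n)) → ∃[ u ] x Over u
  lies-over x with point x
  ... | at-zero    = b , zero-over
  ... | at-partner = c , partner-over
  ... | at-embed y = y , embed-over y

  Step₂ : Fin (2 + n) → Fin (2 + n) → Set
  Step₂ = Step σ₂ τ₂

  connected : {x : Fin (2 + n)} {u : Fin n} → x Over u → Star Step₂ x (embed u) × Star Step₂ (embed u) x
  connected zero-over      = inj₂ (sym τ₂-zero) ◅ ε , inj₂ (sym τ₂-embed-b) ◅ ε
  connected partner-over   = inj₂ (sym τ₂-partner) ◅ ε , inj₂ (sym τ₂-embed-c) ◅ ε
  connected (embed-over y) = ε , ε

  lift-step : {u v : Fin n} → Step σ τ u v → Star Step₂ (embed u) (embed v)
  lift-step {u} (inj₁ refl) = inj₁ (sym (addPair-embed σ u)) ◅ ε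
  lift-step {u} (inj₂ refl) with u ≟ b | u ≟ c
  ... | yes refl | _ =
    inj₂ (sym τ₂-embed-b) ◅ inj₁ (sym (addPair-zero σ)) ◅ inj₂ (sym τ₂-partner) ◅ ε
  ... | no _ | yes refl =
    inj₂ (sym τ₂-embed-c) ◅ inj₁ (sym (addPair-partner σ)) ◅
    inj₂ (trans (cong embed (⟨$⟩-involutive τ b)) (sym τ₂-zero)) ◅ ε
  ... | no u≢b | no u≢c = inj₂ (sym (splitCycle-embed b τ u≢b u≢c)) ◅ ε

  step-over : {x y : Fin (2 + n)} {u : Fin n} → x Over u → Step₂ x y → ∃[ v ] y Over v × Star (Step σ τ) u v
  step-over zero-over      (inj₁ refl) = c , partner-over , inj₂ refl ◅ ε
  step-over zero-over      (inj₂ refl) = b , Over-resp τ₂-zero (embed-over b) , ε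
  step-over partner-over   (inj₁ refl) = b , Over-resp (addPair-partner σ) zero-over , inj₂ (sym (⟨$⟩-involutive τ b)) ◅ ε
  step-over partner-over   (inj₂ refl) = c , Over-resp τ₂-partner (embed-over c) , ε
  step-over (embed-over u) (inj₁ refl) = σ ⟨$⟩ u , Over-resp (addPair-embed σ u) (embed-over _) , inj₁ refl ◅ ε
  step-over (embed-over u) (inj₂ refl) with u ≟ b | u ≟ c
  ... | yes refl | _ = b , Over-resp τ₂-embed-b zero-over , ε
  ... | no _ | yes refl = c , Over-resp τ₂-embed-c partner-over , ε
  ... | no u≢b | no u≢c =
    τ ⟨$⟩ u , Over-resp (splitCycle-embed b τ u≢b u≢c) (embed-over _) , inj₂ refl ◅ ε

  path-over : {x y : Fin (2 + n)} {u : Fin n} → x Over u → Star Step₂ x y → ∃[ v ] y Over v × Star (Step σ τ) u v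
  path-over {u = u} x/u ε = u , x/u , ε
  path-over x/u (s ◅ p) with step-over x/u s
  ... | v , y/v , u⇝v with path-over y/v p
  ...   | w , z/w , v⇝w = w , z/w , u⇝v ◅◅ v⇝w

  splitCycle-transitive : Transitive σ τ → Transitive σ₂ τ₂
  splitCycle-transitive t x y with lies-over x | lies-over y
  ... | u , x/u | v , y/v =
    proj₁ (connected x/u) ◅◅ kleisliStar embed lift-step (t u v) ◅◅ proj₂ (connected y/v)

  splitCycle-transitive⁻¹ : Transitive σ₂ τ₂ → Transitive σ τ
  splitCycle-transitive⁻¹ t u v with path-over (embed-over u) (t (embed u) (embed v))
  ... | w , v/w , u⇝w = subst (Star (Step σ τ) u) (Over-embed v/w refl) u⇝w

partnerIndex : FPFI (2 + n) → Fin (suc n)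
partnerIndex σ = punchOut {i = zero} λ 0≡σ0 → ⟨$⟩-noFix σ zero (sym 0≡σ0)

partnerIndex-correct : (σ : FPFI (2 + n)) → σ ⟨$⟩ zero ≡ WithPartner.partner (partnerIndex σ)
partnerIndex-correct σ = sym (punchIn-punchOut {i = zero} _)

FPFI-step : FPFI (2 + n) ↔ (Fin (suc n) × FPFI n)
FPFI-step = mk↔ₛ′
  (λ σ → partnerIndex σ , removePair (partnerIndex σ) σ (partnerIndex-correct σ))
  (λ (a , σ) → addPair a σ)
  (λ (a , σ) → cong (a ,_) (removePair-addPair a σ refl))
  (λ σ → addPair-removePair (partnerIndex σ) σ (partnerIndex-correct σ))
  where open WithPartner

module SharedPartner {m : ℕ} (σ τ : FPFI m) {i : Fin m} (τi≡σi : τ ⟨$⟩ i ≡ σ ⟨$⟩ i) where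

  Block : Fin m → Set
  Block x = x ≡ i ⊎ x ≡ σ ⟨$⟩ i

  step-preserves-Block : {x y : Fin m} → Block x → Step σ τ x y → Block y
  step-preserves-Block (inj₁ refl) (inj₁ y≡σi)  = inj₂ y≡σi
  step-preserves-Block (inj₁ refl) (inj₂ y≡τi)  = inj₂ (trans y≡τi τi≡σi)
  step-preserves-Block (inj₂ refl) (inj₁ y≡σσi) = inj₁ (trans y≡σσi (⟨$⟩-involutive σ i))
  step-preserves-Block (inj₂ refl) (inj₂ y≡τσi) = inj₁ (trans y≡τσi (⟨$⟩-symmetric τ τi≡σi))

  path-preserves-Block : {x y : Fin m} → Block x → Star (Step σ τ) x y → Block y
  path-preserves-Block x∈ ε       = x∈
  path-preserves-Block x∈ (s ◅ p) = path-preserves-Block (step-preserves-Block x∈ s) p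

-- A point outside {0, σ 0} exists, so {0, σ 0} cannot be an orbit.
transitive⇒τ0≢σ0 : (σ τ : FPFI (2 + n)) → Fin n → Transitive σ τ → τ ⟨$⟩ zero ≢ σ ⟨$⟩ zero
transitive⇒τ0≢σ0 σ τ z t τ0≡σ0 =
  [ embed≢zero , (λ eq → embed≢partner (trans eq (partnerIndex-correct σ))) ]′
    (path-preserves-Block (inj₁ refl) (t zero (embed z)))
  where
  open WithPartner (partnerIndex σ)
  open SharedPartner σ τ τ0≡σ0

record TransitivePair (n : ℕ) : Set where
  constructor transitivePair
  field
    σ τ         : FPFI n
    .transitive : Transitive σ τ

TransitivePair-≡ : {σ σ′ τ τ′ : FPFI n} .{t : Transitive σ τ} .{t′ : Transitive σ′ τ′} →
                   σ ≡ σ′ → τ ≡ τ′ → transitivePair σ τ t ≡ transitivePair σ′ τ′ t′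
TransitivePair-≡ refl refl = refl

module Cut {n : ℕ} (σ τ : FPFI (2 + n)) .(τ0≢σ0 : τ ⟨$⟩ zero ≢ σ ⟨$⟩ zero) where

  a : Fin (suc n)
  a = partnerIndex σ

  open WithPartner a

  b : Fin n
  b = unembed (τ ⟨$⟩ zero) (⟨$⟩-noFix τ zero) (λ eq → τ0≢σ0 (trans eq (sym (partnerIndex-correct σ))))

  τ0≡b : τ ⟨$⟩ zero ≡ embed b
  τ0≡b = sym (embed-unembed _ _ _)

  σ′ τ′ : FPFI n
  σ′ = removePair σ (partnerIndex-correct σ)
  τ′ = mergeCycle b τ τ0≡b

  addPair-σ′ : addPair σ′ ≡ σ
  addPair-σ′ = addPair-removePair σ (partnerIndex-correct σ)

  splitCycle-τ′ : splitCycle b τ′ ≡ τ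
  splitCycle-τ′ = splitCycle-mergeCycle b τ τ0≡b

TransitivePair-step : Fin n → TransitivePair (2 + n) ↔ (Fin (suc n) × Fin n × TransitivePair n)
TransitivePair-step {n} z = mk↔ₛ′ cut glue cut∘glue glue∘cut
  where
  open WithPartner
  open SplitTransitivity using (splitCycle-transitive; splitCycle-transitive⁻¹)

  cut : TransitivePair (2 + n) → Fin (suc n) × Fin n × TransitivePair n
  cut (transitivePair σ τ t) = a , b , transitivePair σ′ τ′
    (splitCycle-transitive⁻¹ a b σ′ τ′ (subst₂ Transitive (sym addPair-σ′) (sym splitCycle-τ′) t))
    where open Cut σ τ (transitive⇒τ0≢σ0 σ τ z t)

  glue : Fin (suc n) × Fin n × TransitivePair n → TransitivePair (2 + n)
  glue (a , b , transitivePair σ τ t) = transitivePair (addPair a σ) (splitCycle a b τ) (splitCycle-transitive a b σ τ t)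

  cut∘glue : ∀ p → cut (glue p) ≡ p
  cut∘glue (a , b , transitivePair σ τ t) = cong (a ,_) (cong₂ _,_ b′≡b
    (TransitivePair-≡ (removePair-addPair a σ refl) (mergeCycle-splitCycle a τ b′≡b τ0≡b′)))
    where
    open Cut (addPair a σ) (splitCycle a b τ) (embed≢partner a ∘ trans (sym (splitCycle-zero a b τ)))
      using () renaming (b to b′; τ0≡b to τ0≡b′)
    b′≡b : b′ ≡ b
    b′≡b = embed-injective a (trans (sym τ0≡b′) (splitCycle-zero a b τ))

  glue∘cut : ∀ p → glue (cut p) ≡ p
  glue∘cut (transitivePair σ τ t) = TransitivePair-≡ addPair-σ′ splitCycle-τ′
    where open Cut σ τ (transitive⇒τ0≢σ0 σ τ z t)

-- oddDoubleFactorial k = (2k − 1)!!  and  evenDoubleFactorial k = (2k)!!.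
oddDoubleFactorial : ℕ → ℕ
oddDoubleFactorial zero    = 1
oddDoubleFactorial (suc k) = suc (2 * k) * oddDoubleFactorial k

evenDoubleFactorial : ℕ → ℕ
evenDoubleFactorial zero    = 1
evenDoubleFactorial (suc k) = 2 * suc k * evenDoubleFactorial k

Fin1↔FPFI₀ : Fin 1 ↔ FPFI 0
Fin1↔FPFI₀ = mk↔ₛ′ (λ _ → fpfi [] (λ ()) (λ ())) (λ _ → zero) (λ { (fpfi [] _ _) → refl }) (λ { zero → refl })

FPFI-count : ∀ k → Fin (oddDoubleFactorial k) ↔ FPFI (2 * k)
FPFI-count zero    = Fin1↔FPFI₀
FPFI-count (suc k) =
  Fin (suc (2 * k) * oddDoubleFactorial k)           ↔⟨ *↔× ⟩
  (Fin (suc (2 * k)) × Fin (oddDoubleFactorial k))   ↔⟨ ↔-refl ×-↔ FPFI-count k ⟩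
  (Fin (suc (2 * k)) × FPFI (2 * k))                 ↔⟨ FPFI-step ⟨
  FPFI (2 + 2 * k)                                   ≡⟨ cong FPFI (sym (*-suc 2 k)) ⟩
  FPFI (2 * suc k)                                   ∎
  where open EquationalReasoning

FPFI₂-unique : (σ τ : FPFI 2) → σ ≡ τ
FPFI₂-unique σ τ = trans (sym (strictlyInverseˡ σ)) (trans (cong to (Fin₁-unique (from σ) (from τ))) (strictlyInverseˡ τ))
  where
  open Inverse (FPFI-count 1)
  Fin₁-unique : (i j : Fin 1) → i ≡ j
  Fin₁-unique zero zero = refl

other-point : {x y z : Fin 2} → y ≢ x → z ≢ x → y ≡ z
other-point {zero}     {zero}                y≢x _   = ⊥-elim (y≢x refl)
other-point {zero}     {suc zero} {zero}     _   z≢x = ⊥-elim (z≢x refl)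
other-point {zero}     {suc zero} {suc zero} _   _   = refl
other-point {suc zero} {suc zero}            y≢x _   = ⊥-elim (y≢x refl)
other-point {suc zero} {zero}     {suc zero} _   z≢x = ⊥-elim (z≢x refl)
other-point {suc zero} {zero}     {zero}     _   _   = refl

transitive-on-two : (σ : FPFI 2) → Transitive σ σ
transitive-on-two σ x y with x ≟ y
... | yes refl = ε
... | no x≢y   = inj₁ (other-point (x≢y ∘ sym) (⟨$⟩-noFix σ x)) ◅ ε

Fin1↔TransitivePair₂ : Fin 1 ↔ TransitivePair 2
Fin1↔TransitivePair₂ = mk↔ₛ′ (λ _ → transitivePair σ σ (transitive-on-two σ)) (λ _ → zero)
  (λ (transitivePair σ′ τ′ _) → TransitivePair-≡ (FPFI₂-unique σ σ′) (FPFI₂-unique σ τ′))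
  (λ { zero → refl })
  where
  σ : FPFI 2
  σ = Inverse.to (FPFI-count 1) zero

TransitivePair-count : ∀ k → Fin (oddDoubleFactorial (suc k) * evenDoubleFactorial k) ↔ TransitivePair (2 * suc k)
TransitivePair-count zero    = Fin1↔TransitivePair₂
TransitivePair-count (suc k) =
  Fin (oddDoubleFactorial (2 + k) * evenDoubleFactorial (suc k))   ≡⟨ cong Fin (regroup (suc (2 * suc k)) (2 * suc k) m d) ⟩
  Fin (suc (2 * suc k) * (2 * suc k * (m * d)))                    ↔⟨ *↔× ⟩
  (Fin (suc (2 * suc k)) × Fin (2 * suc k * (m * d)))              ↔⟨ ↔-refl ×-↔ *↔× ⟩
  (Fin (suc (2 * suc k)) × Fin (2 * suc k) × Fin (m * d))          ↔⟨ ↔-refl ×-↔ (↔-refl ×-↔ TransitivePair-count k) ⟩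
  (Fin (suc (2 * suc k)) × Fin (2 * suc k) × TransitivePair (2 * suc k)) ↔⟨ TransitivePair-step zero ⟨
  TransitivePair (2 + 2 * suc k)                                   ≡⟨ cong TransitivePair (sym (*-suc 2 (suc k))) ⟩
  TransitivePair (2 * suc (suc k))                                 ∎
  where
  open EquationalReasoning
  m d : ℕ
  m = oddDoubleFactorial (suc k)
  d = evenDoubleFactorial k
  regroup : ∀ p q x y → (p * x) * (q * y) ≡ p * (q * (x * y))
  regroup = solve-∀

wallis-lower : ∀ k → let m = oddDoubleFactorial (suc k); d = evenDoubleFactorial k in
               suc k * (d * d) ≤ m * m
wallis-lower zero    = ≤-refl
wallis-lower (suc k) = begin
  suc (suc k) * ((b * d) * (b * d))   ≡⟨ regroup k d ⟩
  c * (suc k * (d * d))               ≤⟨ *-monoʳ-≤ c (wallis-lower k) ⟩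
  c * (m * m)                         ≤⟨ *-monoˡ-≤ (m * m) (n≤1+n c) ⟩
  suc c * (m * m)                     ≡⟨ complete-square k m ⟩
  (a * m) * (a * m)                   ∎
  where
  open ≤-Reasoning
  m d a b : ℕ
  m = oddDoubleFactorial (suc k)
  d = evenDoubleFactorial k
  a = suc (2 * suc k)
  b = 2 * suc k
  c : ℕ
  c = 4 * suc k * suc (suc k)
  regroup : ∀ k d → suc (suc k) * ((2 * suc k * d) * (2 * suc k * d)) ≡ 4 * suc k * suc (suc k) * (suc k * (d * d))
  regroup = solve-∀
  complete-square : ∀ k m → suc (4 * suc k * suc (suc k)) * (m * m) ≡ (suc (2 * suc k) * m) * (suc (2 * suc k) * m)
  complete-square = solve-∀

-- The constant 4k + 3, sharper than 4(k + 1), is what lets the induction close.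
wallis-upper : ∀ k → let m = oddDoubleFactorial (suc k); d = evenDoubleFactorial k in
               3 * (m * m) ≤ (4 * k + 3) * (d * d)
wallis-upper zero    = ≤-refl
wallis-upper (suc k) = begin
  3 * ((a * m) * (a * m))               ≡⟨ regroup k m ⟩
  (a * a) * (3 * (m * m))               ≤⟨ *-monoʳ-≤ (a * a) (wallis-upper k) ⟩
  (a * a) * ((4 * k + 3) * (d * d))     ≡⟨ *-assoc (a * a) (4 * k + 3) (d * d) ⟨
  (a * a) * (4 * k + 3) * (d * d)       ≤⟨ *-monoˡ-≤ (d * d) (n≤1+n ((a * a) * (4 * k + 3))) ⟩
  suc ((a * a) * (4 * k + 3)) * (d * d) ≡⟨ complete-cube k d ⟩
  (4 * suc k + 3) * ((b * d) * (b * d)) ∎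
  where
  open ≤-Reasoning
  m d a b : ℕ
  m = oddDoubleFactorial (suc k)
  d = evenDoubleFactorial k
  a = suc (2 * suc k)
  b = 2 * suc k
  regroup : ∀ k m → 3 * ((suc (2 * suc k) * m) * (suc (2 * suc k) * m)) ≡ (suc (2 * suc k) * suc (2 * suc k)) * (3 * (m * m))
  regroup = solve-∀
  complete-cube : ∀ k d → suc ((suc (2 * suc k) * suc (2 * suc k)) * (4 * k + 3)) * (d * d)
                        ≡ (4 * suc k + 3) * ((2 * suc k * d) * (2 * suc k * d))
  complete-cube = solve-∀

module CountBounds (k : ℕ) where

  m d : ℕ
  m = oddDoubleFactorial (suc k)
  d = evenDoubleFactorial k

  private
    m⁴≡m²m² : ∀ m → m * (m * (m * (m * 1))) ≡ (m * m) * (m * m)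
    m⁴≡m²m² = solve-∀
    k[md]²≡m²[kd²] : ∀ k m d → k * ((m * d) * ((m * d) * 1)) ≡ (m * m) * (k * (d * d))
    k[md]²≡m²[kd²] = solve-∀

  kT²≤M⁴ : suc k * (m * d) ^ 2 ≤ m ^ 4
  kT²≤M⁴ = begin
    suc k * (m * d) ^ 2          ≡⟨ k[md]²≡m²[kd²] (suc k) m d ⟩
    (m * m) * (suc k * (d * d))  ≤⟨ *-monoʳ-≤ (m * m) (wallis-lower k) ⟩
    (m * m) * (m * m)            ≡⟨ m⁴≡m²m² m ⟨
    m ^ 4                        ∎
    where open ≤-Reasoning

  m²≤4kd² : m * m ≤ 4 * (suc k * (d * d))
  m²≤4kd² = begin
    m * m                         ≤⟨ m≤n*m (m * m) 3 ⟩
    3 * (m * m)                   ≤⟨ wallis-upper k ⟩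
    (4 * k + 3) * (d * d)         ≤⟨ *-monoˡ-≤ (d * d) (n≤1+n (4 * k + 3)) ⟩
    suc (4 * k + 3) * (d * d)     ≡⟨ [4k+4]x≡4[[k+1]x] k (d * d) ⟩
    4 * (suc k * (d * d))         ∎
    where
    open ≤-Reasoning
    [4k+4]x≡4[[k+1]x] : ∀ k x → suc (4 * k + 3) * x ≡ 4 * (suc k * x)
    [4k+4]x≡4[[k+1]x] = solve-∀

  M⁴≤4kT² : m ^ 4 ≤ 4 * (suc k * (m * d) ^ 2)
  M⁴≤4kT² = begin
    m ^ 4                                ≡⟨ m⁴≡m²m² m ⟩
    (m * m) * (m * m)                    ≤⟨ *-monoʳ-≤ (m * m) m²≤4kd² ⟩
    (m * m) * (4 * (suc k * (d * d)))    ≡⟨ x∙yz≈y∙xz (m * m) 4 (suc k * (d * d)) ⟩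
    4 * ((m * m) * (suc k * (d * d)))    ≡⟨ cong (4 *_) (k[md]²≡m²[kd²] (suc k) m d) ⟨
    4 * (suc k * (m * d) ^ 2)            ∎
    where open ≤-Reasoning

ℕtoℚ-mkℚ : ∀ x → ℕtoℚ x ≡ mkℚ (+ x) 0 (coprime-sym (1-coprimeTo x))
ℕtoℚ-mkℚ x = normalize-coprime (coprime-sym (1-coprimeTo x))

module _ {p q-1 : ℕ} .{c : Coprime p (suc q-1)} (x y : ℕ) where
  private
    r x/1 : ℚ
    r   = mkℚ (+ p) q-1 c
    x/1 = mkℚ (+ x) 0 (coprime-sym (1-coprimeTo x))

    toℚᵘ-r*x : toℚᵘ (r *ℚ x/1) ℚᵘ.≃ toℚᵘ r ℚᵘ.* toℚᵘ x/1
    toℚᵘ-r*x = toℚᵘ-homo-* r x/1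

    numerator : + (p * x) ≡ (+ p ℤ.* + x) ℤ.* + 1
    numerator = trans (ℤ.pos-* p x) (sym (ℤ.*-identityʳ _))

    denominator : + (y * suc q-1) ≡ + y ℤ.* + (suc q-1 * 1)
    denominator = trans (ℤ.pos-* y (suc q-1)) (cong (λ q → + y ℤ.* + q) (sym (*-identityʳ (suc q-1))))

  *ℕtoℚ≤ℕtoℚ : p * x ≤ y * suc q-1 → r *ℚ ℕtoℚ x ≤ℚ ℕtoℚ y
  *ℕtoℚ≤ℕtoℚ px≤yq rewrite ℕtoℚ-mkℚ x | ℕtoℚ-mkℚ y = toℚᵘ-cancel-≤
    (ℚᵘ.≤-respˡ-≃ (ℚᵘ.≃-sym toℚᵘ-r*x) (ℚᵘ.*≤* (subst₂ ℤ._≤_ numerator denominator (ℤ.+≤+ px≤yq))))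

  ℕtoℚ≤*ℕtoℚ : y * suc q-1 ≤ p * x → ℕtoℚ y ≤ℚ r *ℚ ℕtoℚ x
  ℕtoℚ≤*ℕtoℚ yq≤px rewrite ℕtoℚ-mkℚ x | ℕtoℚ-mkℚ y = toℚᵘ-cancel-≤
    (ℚᵘ.≤-respʳ-≃ (ℚᵘ.≃-sym toℚᵘ-r*x) (ℚᵘ.*≤* (subst₂ ℤ._≤_ denominator numerator (ℤ.+≤+ yq≤px))))

TransPair↔TransitivePair : ∀ k → TransPair k ↔ TransitivePair (2 * k)
TransPair↔TransitivePair k = mk↔ₛ′ (λ (tpair σ τ t) → transitivePair σ τ t) (λ (transitivePair σ τ t) → tpair σ τ t)
  (λ _ → refl) (λ _ → refl)

FPFI-cardinality : ∀ {k M} → Fin M ↔ FPFI (2 * k) → M ≡ oddDoubleFactorial k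
FPFI-cardinality {k} M↔ = ↔⇒≡ (↔-trans M↔ (↔-sym (FPFI-count k)))

TransPair-cardinality : ∀ {k T} → Fin T ↔ TransPair (suc k) → T ≡ oddDoubleFactorial (suc k) * evenDoubleFactorial k
TransPair-cardinality {k} T↔ =
  ↔⇒≡ (↔-trans T↔ (↔-trans (TransPair↔TransitivePair (suc k)) (↔-sym (TransitivePair-count k))))

lemma2p1 : ∃[ a ] ∃[ b ] (0ℚ <ℚ a) × (a <ℚ b) ×
    (∀ (k M T : ℕ) → 1 ≤ k →
    (Fin M ↔ FPFI (2 * k)) → (Fin T ↔ TransPair k) →
    ((a *ℚ a) *ℚ ℕtoℚ (M ^ 4) ≤ℚ ℕtoℚ (k * (T ^ 2)))
    × (ℕtoℚ (k * (T ^ 2)) ≤ℚ (b *ℚ b) *ℚ ℕtoℚ (M ^ 4)))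
lemma2p1 = ½ , 1ℚ , toWitness {a? = 0ℚ <? ½} tt , toWitness {a? = ½ <? 1ℚ} tt , bounds
  where
  Bounds : ℕ → ℕ → ℕ → Set
  Bounds k M T = ((½ *ℚ ½) *ℚ ℕtoℚ (M ^ 4) ≤ℚ ℕtoℚ (k * (T ^ 2))) ×
                 (ℕtoℚ (k * (T ^ 2)) ≤ℚ (1ℚ *ℚ 1ℚ) *ℚ ℕtoℚ (M ^ 4))

  bounds : ∀ k M T → 1 ≤ k → (Fin M ↔ FPFI (2 * k)) → (Fin T ↔ TransPair k) → Bounds k M T
  bounds (suc k) M T _ M↔ T↔ =
    subst₂ (Bounds (suc k)) (sym (FPFI-cardinality {suc k} M↔)) (sym (TransPair-cardinality {k} T↔))
      ( *ℕtoℚ≤ℕtoℚ (m ^ 4) kT² (subst₂ _≤_ (sym (*-identityˡ (m ^ 4))) (*-comm 4 kT²) M⁴≤4kT²)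
      , ℕtoℚ≤*ℕtoℚ (m ^ 4) kT² (subst₂ _≤_ (sym (*-identityʳ kT²)) (sym (*-identityˡ (m ^ 4))) kT²≤M⁴))
    where
    open CountBounds k
    kT² : ℕ
    kT² = suc k * (m * d) ^ 2
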